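{- Let $\Delta$ be a simplicial complex with at least one vertex, with facets $A_1,\dots,A_r$, and let $d$ be the maximum cardinality of a facet of $\Delta$. Then for every integer $k\ge 1$, $$h_k(\Delta)=(-1)^{k-1}\sum_{j\ge 1}\binom{d-j}{k-1}\tilde\chi(N_j(\Delta)),$$ with the convention $\binom{a}{b}=0$ whenever $a<b$.
   Context: $f_{i}(\Delta)$ is the number of faces of $\Delta$ of cardinality $i+1$ (with $f_{ -1}=1$), and the $h$-vector $(h_0,\dots,h_d)$ of $\Delta$ is given by $h_k=\sum_{i=0}^k\binom{d-i}{k-i}(-1)^{k-i}f_{i-1}$. For an integer $j$, $N_j(\Delta)=\{F\subseteq[r] : |\bigcap_{l\in F}A_l|\ge j\}$ is the $j$-th nerve complex of $\Delta$ (the empty set is always a face). $\tilde\chi$ denotes the reduced Euler characteristic, $\tilde\chi(K)=\sum_{h\ge -1}(-1)^h\#\{h\text{ -dimensional faces of }K\}$, counting $\varnothing$ in dimension $-1$. -}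

module Defs where

open import Data.Nat using (ℕ; zero; suc; _∸_; _≤_; _⊔_)
open import Data.Nat.Combinatorics using (_C_)
open import Data.Integer as ℤ using (ℤ; +_; -_)
open import Data.Fin using (Fin)
open import Data.Fin.Subset using (Subset; _⊆_; _∈_; ∣_∣; inside; outside)
open import Data.Fin.Subset.Properties using (_⊆?_; _∈?_)
open import Data.Fin.Properties using (any?; all?)
open import Data.Vec using (Vec; []; _∷_; tabulate)
open import Data.List using (List; []; _∷_; _++_; map; filter; length; foldr)
open import Data.Bool using (Bool; true; false)
open import Data.Product using (Σ; ∃; _×_; _,_)
open import Data.Sum using (_⊎_)
open import Relation.Nullary using (Dec; yes; no; does; _⊎-dec_; _×-dec_)
open import Relation.Binary.PropositionalEquality using (_≡_)
import Data.Nat.Properties as ℕP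

-- A simplicial complex Δ on the vertex set Fin n, given by its list of
-- facets A : Fin r → Subset n.  Its faces are the subsets of Fin n
-- contained in some facet.

allSubsets : (n : ℕ) → List (Subset n)
allSubsets zero = [] ∷ []
allSubsets (suc n) = map (outside ∷_) (allSubsets n) ++ map (inside ∷_) (allSubsets n)

IsFace : ∀ {n r} → (Fin r → Subset n) → Subset n → Set
IsFace A S = ∃ λ l → S ⊆ A l

isFace? : ∀ {n r} (A : Fin r → Subset n) (S : Subset n) → Dec (IsFace A S)
isFace? A S = any? (λ l → S ⊆? A l)

-- number of faces of cardinality i, i.e. f_{i-1}(Δ)
fcard : ∀ {n r} → (Fin r → Subset n) → ℕ → ℕ
fcard {n} A i = length (filter (λ S → (∣ S ∣ ℕP.≟ i) ×-dec isFace? A S) (allSubsets n))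

maxFacetSize : ∀ {n r} → (Fin r → Subset n) → ℕ
maxFacetSize {r = r} A = foldr (λ l m → ∣ A l ∣ ⊔ m) 0 (Data.List.allFin r)
  where import Data.List

neg1^ : ℕ → ℤ
neg1^ zero = + 1
neg1^ (suc m) = - neg1^ m

-- Σ_{i=a}^{b} g i  (0 if b < a) : sum over i = 0..b of [a ≤ i] g i
sumFromTo : ℕ → ℕ → (ℕ → ℤ) → ℤ
sumFromTo a zero g with a
... | zero = g 0
... | suc _ = + 0
sumFromTo a (suc b) g with Data.Nat._≤?_ a (suc b)
  where import Data.Nat
... | yes _ = sumFromTo a b g ℤ.+ g (suc b)
... | no _ = sumFromTo a b g

-- h_k(Δ) = Σ_{i=0}^k binom(d-i, k-i) (-1)^{k-i} f_{i-1}(Δ)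
-- (terms with i > d vanish since f_{i-1} = 0 there)
hVec : ∀ {n r} → (Fin r → Subset n) → ℕ → ℤ
hVec A k = sumFromTo 0 k (λ i → (+ ((d ∸ i) C (k ∸ i))) ℤ.* (neg1^ (k ∸ i) ℤ.* (+ fcard A i)))
  where d = maxFacetSize A

interFacets : ∀ {n r} → (Fin r → Subset n) → Subset r → Subset n
interFacets A F = tabulate (λ v → does (all? (λ l → (l ∈? F) →-dec (v ∈? A l))))
  where
  _→-dec_ : ∀ {P Q : Set} → Dec P → Dec Q → Dec (P → Q)
  _→-dec_ = Relation.Nullary.Decidable._→-dec_
    where import Relation.Nullary.Decidable

-- faces of the j-th nerve complex N_j(Δ): F ⊆ [r] with F = ∅ or
-- |⋂_{l∈F} A_l| ≥ j  (the empty set is always a face)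
InNerve : ∀ {n r} → (Fin r → Subset n) → ℕ → Subset r → Set
InNerve A j F = (∣ F ∣ ≡ 0) ⊎ (j ≤ ∣ interFacets A F ∣)

inNerve? : ∀ {n r} (A : Fin r → Subset n) (j : ℕ) (F : Subset r) → Dec (InNerve A j F)
inNerve? A j F = (∣ F ∣ ℕP.≟ 0) ⊎-dec (j ℕP.≤? ∣ interFacets A F ∣)

-- sign of a face F in the reduced Euler characteristic: (-1)^{dim F},
-- dim F = |F| - 1 (the empty face contributes (-1)^{-1} = -1)
faceSign : ℕ → ℤ
faceSign zero = - (+ 1)
faceSign (suc m) = neg1^ m

redEulerNerve : ∀ {n r} → (Fin r → Subset n) → ℕ → ℤ
redEulerNerve {r = r} A j =
  foldr ℤ._+_ (+ 0) (map (λ F → faceSign ∣ F ∣) (filter (inNerve? A j) (allSubsets r)))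

module Submission where

-- Let s_F = |⋂_{l∈F} A_l| and Φ(g) = Σ_{∅≠F⊆[r]} (-1)^{|F|} g(F) (the signed nerve sum).
-- Both sides are shown to equal Φ(F ↦ (-1)^{k-1} binom(d - s_F, k)), using s_F ≤ d for F ≠ ∅.
--  * Left: inclusion–exclusion over the facets gives [S ∈ Δ] = -Φ(F ↦ [S ⊆ ⋂_F A]), so
--    f_{i-1}(Δ) = -Φ(F ↦ binom(s_F, i)); the h-transform is linear and maps binom(s, ·)
--    to (-1)^k binom(d - s, k) (the h-vector of a simplex, by Pascal's rule).
--  * Right: as Σ_{F⊆[r]} (-1)^{|F|} = 0 for r ≥ 1, χ̃(N_j) = Φ(F ↦ [s_F < j]), and the
--    hockey-stick identity sums Σ_{j=1}^{d} binom(d-j, k-1) [s_F < j] to binom(d - s_F, k).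

open import Defs
open import Data.Nat as ℕ using (ℕ; zero; suc; _∸_; _≤_; _⊔_; s≤s)
import Data.Nat.Properties as NP
open import Data.Nat.Combinatorics using (_C_; nCk+nC[k+1]≡[n+1]C[k+1])
open import Data.Integer using (ℤ; +_; -_; _+_; _*_; _-_)
import Data.Integer.Properties as ZP
open import Data.Integer.Tactic.RingSolver using (solve-∀)
open import Data.Fin using (Fin; zero; suc)
open import Data.Fin.Subset using (Subset; _⊆_; _∈_; ∣_∣; inside; outside; ⊥; ⊤; Nonempty)
open import Data.Fin.Subset.Properties using (_⊆?_; _∈?_; ∣⊥∣≡0; p⊆q⇒∣p∣≤∣q∣; nonempty?; Empty-unique)
open import Data.Fin.Properties using (any?; all?)
open import Data.Vec using ([]; _∷_; here; there)
open import Data.Vec.Properties using (lookup∘tabulate; []=⇒lookup; lookup⇒[]=)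
open import Data.List using (List; []; _∷_; _++_; map; filter; length; foldr; allFin)
import Data.List.Relation.Unary.Any as Any
open import Data.List.Membership.Propositional using () renaming (_∈_ to _∈ₗ_)
open import Data.List.Membership.Propositional.Properties using (∈-allFin)
open import Data.Bool using (if_then_else_)
open import Data.Product using (∃; _×_; _,_)
open import Data.Sum using (inj₁; inj₂)
open import Relation.Nullary using (Dec; yes; no; does; proof; ¬_; contradiction; _×-dec_)
open import Relation.Nullary.Decidable using (_→-dec_; dec-true)
open import Relation.Nullary.Reflects using (Reflects; invert)
open import Relation.Unary using (Pred; Decidable)
open import Relation.Binary.PropositionalEquality
open import Function using (_∘_)

𝟙 : ∀ {p} {P : Set p} → Dec P → ℤ
𝟙 d = if does d then + 1 else + 0

𝟙-cong : ∀ {p q} {P : Set p} {Q : Set q} → (P → Q) → (Q → P) →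
  (a : Dec P) (b : Dec Q) → 𝟙 a ≡ 𝟙 b
𝟙-cong f g (yes p) (yes q) = refl
𝟙-cong f g (no ¬p) (no ¬q) = refl
𝟙-cong f g (yes p) (no ¬q) = contradiction (f p) ¬q
𝟙-cong f g (no ¬p) (yes q) = contradiction (g q) ¬p

𝟙-yes : ∀ {p} {P : Set p} (d : Dec P) → P → 𝟙 d ≡ + 1
𝟙-yes (yes _) _ = refl
𝟙-yes (no ¬p) p = contradiction p ¬p

𝟙-× : ∀ {p q} {P : Set p} {Q : Set q} (a : Dec P) (b : Dec Q) → 𝟙 (a ×-dec b) ≡ 𝟙 a * 𝟙 b
𝟙-× (yes _) (yes _) = refl
𝟙-× (yes _) (no _) = refl
𝟙-× (no _) _ = refl

-- Finite sums over a list; definitionally the fold used by `redEulerNerve`.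
∑ : ∀ {a} {X : Set a} → List X → (X → ℤ) → ℤ
∑ xs f = foldr _+_ (+ 0) (map f xs)

module _ {a} {X : Set a} where

  ∑-cong : ∀ (xs : List X) {f g : X → ℤ} → (∀ x → f x ≡ g x) → ∑ xs f ≡ ∑ xs g
  ∑-cong [] e = refl
  ∑-cong (x ∷ xs) e = cong₂ _+_ (e x) (∑-cong xs e)

  ∑-++ : ∀ (xs ys : List X) f → ∑ (xs ++ ys) f ≡ ∑ xs f + ∑ ys f
  ∑-++ [] ys f = sym (ZP.+-identityˡ _)
  ∑-++ (x ∷ xs) ys f = trans (cong (_+_ (f x)) (∑-++ xs ys f)) (sym (ZP.+-assoc (f x) _ _))

  ∑-zero : ∀ (xs : List X) → ∑ xs (λ _ → + 0) ≡ + 0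
  ∑-zero [] = refl
  ∑-zero (x ∷ xs) = trans (ZP.+-identityˡ _) (∑-zero xs)

  ∑-+ : ∀ (xs : List X) f g → ∑ xs (λ x → f x + g x) ≡ ∑ xs f + ∑ xs g
  ∑-+ [] f g = refl
  ∑-+ (x ∷ xs) f g = trans (cong (_+_ (f x + g x)) (∑-+ xs f g)) (interchange (f x) (g x) _ _)
    where
    interchange : ∀ a b c d → (a + b) + (c + d) ≡ (a + c) + (b + d)
    interchange = solve-∀

  ∑-* : ∀ (xs : List X) c f → ∑ xs (λ x → c * f x) ≡ c * ∑ xs f
  ∑-* [] c f = sym (ZP.*-zeroʳ c)
  ∑-* (x ∷ xs) c f = trans (cong (_+_ (c * f x)) (∑-* xs c f)) (sym (ZP.*-distribˡ-+ c (f x) _))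

  ∑-neg : ∀ (xs : List X) f → ∑ xs (λ x → - f x) ≡ - ∑ xs f
  ∑-neg xs f = begin
    ∑ xs (λ x → - f x)        ≡⟨ ∑-cong xs (λ x → sym (ZP.-1*i≡-i (f x))) ⟩
    ∑ xs (λ x → - + 1 * f x)  ≡⟨ ∑-* xs (- + 1) f ⟩
    - + 1 * ∑ xs f            ≡⟨ ZP.-1*i≡-i _ ⟩
    - ∑ xs f                  ∎
    where open ≡-Reasoning

  ∑-filter : ∀ {p} {P : Pred X p} (P? : Decidable P) (xs : List X) h →
    ∑ (filter P? xs) h ≡ ∑ xs (λ x → 𝟙 (P? x) * h x)
  ∑-filter P? [] h = refl
  ∑-filter P? (x ∷ xs) h with P? x
  ... | yes _ = cong₂ _+_ (sym (ZP.*-identityˡ (h x))) (∑-filter P? xs h)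
  ... | no _ = trans (∑-filter P? xs h) (sym (ZP.+-identityˡ _))

  length-filter : ∀ {p} {P : Pred X p} (P? : Decidable P) (xs : List X) →
    + length (filter P? xs) ≡ ∑ xs (λ x → 𝟙 (P? x))
  length-filter P? [] = refl
  length-filter P? (x ∷ xs) with P? x
  ... | yes _ = trans (ZP.pos-+ 1 _) (cong (_+_ (+ 1)) (length-filter P? xs))
  ... | no _ = trans (length-filter P? xs) (sym (ZP.+-identityˡ _))

∑-map : ∀ {a b} {X : Set a} {Y : Set b} (g : X → Y) (xs : List X) f →
  ∑ (map g xs) f ≡ ∑ xs (f ∘ g)
∑-map g [] f = refl
∑-map g (x ∷ xs) f = cong (_+_ (f (g x))) (∑-map g xs f)

∑-swap : ∀ {a b} {X : Set a} {Y : Set b} (xs : List X) (ys : List Y) (f : X → Y → ℤ) →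
  ∑ xs (λ x → ∑ ys (f x)) ≡ ∑ ys (λ y → ∑ xs (λ x → f x y))
∑-swap [] ys f = sym (∑-zero ys)
∑-swap (x ∷ xs) ys f =
  trans (cong (_+_ (∑ ys (f x))) (∑-swap xs ys f)) (sym (∑-+ ys (f x) (λ y → ∑ xs (λ x → f x y))))

∑-subsets-suc : ∀ r (f : Subset (suc r) → ℤ) →
  ∑ (allSubsets (suc r)) f
    ≡ ∑ (allSubsets r) (f ∘ (outside ∷_)) + ∑ (allSubsets r) (f ∘ (inside ∷_))
∑-subsets-suc r f = trans (∑-++ (map (outside ∷_) (allSubsets r)) _ f)
  (cong₂ _+_ (∑-map (outside ∷_) (allSubsets r) f) (∑-map (inside ∷_) (allSubsets r) f))

alternating-sum-zero : ∀ r → ∑ (allSubsets (suc r)) (λ F → neg1^ ∣ F ∣) ≡ + 0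
alternating-sum-zero r = begin
  ∑ (allSubsets (suc r)) (λ F → neg1^ ∣ F ∣)           ≡⟨ ∑-subsets-suc r _ ⟩
  ∑ Fs (λ F → neg1^ ∣ F ∣) + ∑ Fs (λ F → - neg1^ ∣ F ∣) ≡⟨ cong (_+_ (∑ Fs _)) (∑-neg Fs _) ⟩
  ∑ Fs (λ F → neg1^ ∣ F ∣) - ∑ Fs (λ F → neg1^ ∣ F ∣)   ≡⟨ ZP.+-inverseʳ (∑ Fs _) ⟩
  + 0                                                   ∎
  where
  open ≡-Reasoning
  Fs : List (Subset r)
  Fs = allSubsets r

alternating-complement : ∀ r (h : Subset (suc r) → ℤ) →
  ∑ (allSubsets (suc r)) (λ F → neg1^ ∣ F ∣ * (+ 1 - h F))
    ≡ - ∑ (allSubsets (suc r)) (λ F → neg1^ ∣ F ∣ * h F)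
alternating-complement r h = begin
  ∑ Fs (λ F → neg1^ ∣ F ∣ * (+ 1 - h F))
    ≡⟨ ∑-cong Fs (λ F → expand (neg1^ ∣ F ∣) (h F)) ⟩
  ∑ Fs (λ F → neg1^ ∣ F ∣ + - (neg1^ ∣ F ∣ * h F))
    ≡⟨ ∑-+ Fs _ _ ⟩
  ∑ Fs (λ F → neg1^ ∣ F ∣) + ∑ Fs (λ F → - (neg1^ ∣ F ∣ * h F))
    ≡⟨ cong₂ _+_ (alternating-sum-zero r) (∑-neg Fs _) ⟩
  + 0 + - ∑ Fs (λ F → neg1^ ∣ F ∣ * h F)
    ≡⟨ ZP.+-identityˡ _ ⟩
  - ∑ Fs (λ F → neg1^ ∣ F ∣ * h F) ∎
  where
  open ≡-Reasoning
  Fs : List (Subset (suc r))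
  Fs = allSubsets (suc r)
  expand : ∀ e x → e * (+ 1 - x) ≡ e + - (e * x)
  expand = solve-∀

rsign : ∀ {r} → Subset r → ℤ
rsign [] = + 0
rsign (outside ∷ F) = rsign F
rsign (inside ∷ F) = neg1^ ∣ inside ∷ F ∣

rsign-empty : ∀ {r} (F : Subset r) → ∣ F ∣ ≡ 0 → rsign F ≡ + 0
rsign-empty [] _ = refl
rsign-empty (outside ∷ F) e = rsign-empty F e
rsign-empty (inside ∷ F) ()

signedSum : ∀ {r} → (Subset r → ℤ) → ℤ
signedSum {r} g = ∑ (allSubsets r) (λ F → rsign F * g F)

alternating-split : ∀ r (g : Subset r → ℤ) →
  ∑ (allSubsets r) (λ F → neg1^ ∣ F ∣ * g F) ≡ g ⊥ + signedSum g
alternating-split zero g = base (g [])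
  where
  base : ∀ a → + 1 * a + + 0 ≡ a + (+ 0 * a + + 0)
  base = solve-∀
alternating-split (suc r) g = begin
  ∑ (allSubsets (suc r)) (λ F → neg1^ ∣ F ∣ * g F)
    ≡⟨ ∑-subsets-suc r _ ⟩
  ∑ (allSubsets r) (λ F → neg1^ ∣ F ∣ * g (outside ∷ F)) + T
    ≡⟨ cong (_+ T) (alternating-split r (g ∘ (outside ∷_))) ⟩
  (g ⊥ + signedSum (g ∘ (outside ∷_))) + T
    ≡⟨ ZP.+-assoc (g ⊥) _ T ⟩
  g ⊥ + (signedSum (g ∘ (outside ∷_)) + T)
    ≡⟨ cong (_+_ (g ⊥)) (sym (∑-subsets-suc r _)) ⟩
  g ⊥ + signedSum g ∎
  where
  open ≡-Reasoning
  T : ℤ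
  T = ∑ (allSubsets r) (λ F → rsign (inside ∷ F) * g (inside ∷ F))

signedSum-cong : ∀ {r} {g h : Subset r → ℤ} →
  (∀ F → ¬ ∣ F ∣ ≡ 0 → g F ≡ h F) → signedSum g ≡ signedSum h
signedSum-cong {r} {g} {h} eq = ∑-cong (allSubsets r) pointwise
  where
  pointwise : ∀ F → rsign F * g F ≡ rsign F * h F
  pointwise F with ∣ F ∣ NP.≟ 0
  ... | yes empty rewrite rsign-empty F empty = refl
  ... | no nonempty = cong (rsign F *_) (eq F nonempty)

signedSum-scale : ∀ {r} c (g : Subset r → ℤ) → c * signedSum g ≡ signedSum (λ F → c * g F)
signedSum-scale {r} c g = trans (sym (∑-* (allSubsets r) c _))
  (∑-cong (allSubsets r) (λ F → reorder c (rsign F) (g F)))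
  where
  reorder : ∀ c w x → c * (w * x) ≡ w * (c * x)
  reorder = solve-∀

signedSum-neg : ∀ {r} (g : Subset r → ℤ) → - signedSum g ≡ signedSum (λ F → - g F)
signedSum-neg g = trans (sym (ZP.-1*i≡-i _))
  (trans (signedSum-scale (- + 1) g) (signedSum-cong (λ F _ → ZP.-1*i≡-i (g F))))

signedSum-combination : ∀ {a r} {X : Set a} (xs : List X) (c : X → ℤ) (g : X → Subset r → ℤ) →
  ∑ xs (λ x → c x * signedSum (g x)) ≡ signedSum (λ F → ∑ xs (λ x → c x * g x F))
signedSum-combination {r = r} xs c g = begin
  ∑ xs (λ x → c x * signedSum (g x))
    ≡⟨ ∑-cong xs (λ x → signedSum-scale (c x) (g x)) ⟩
  ∑ xs (λ x → ∑ Fs (λ F → rsign F * (c x * g x F)))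
    ≡⟨ ∑-swap xs Fs _ ⟩
  ∑ Fs (λ F → ∑ xs (λ x → rsign F * (c x * g x F)))
    ≡⟨ ∑-cong Fs (λ F → ∑-* xs (rsign F) _) ⟩
  signedSum (λ F → ∑ xs (λ x → c x * g x F)) ∎
  where
  open ≡-Reasoning
  Fs : List (Subset r)
  Fs = allSubsets r

∏∈ : ∀ {r} → Subset r → (Fin r → ℤ) → ℤ
∏∈ [] x = + 1
∏∈ (outside ∷ F) x = ∏∈ F (x ∘ suc)
∏∈ (inside ∷ F) x = x zero * ∏∈ F (x ∘ suc)

∏∈-⊥ : ∀ r (x : Fin r → ℤ) → ∏∈ ⊥ x ≡ + 1
∏∈-⊥ zero x = refl
∏∈-⊥ (suc r) x = ∏∈-⊥ r (x ∘ suc)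

inclusion-exclusion : ∀ r (x : Fin r → ℤ) →
  ∑ (allSubsets r) (λ F → neg1^ ∣ F ∣ * ∏∈ F x) ≡ ∏∈ ⊤ (λ l → + 1 - x l)
inclusion-exclusion zero x = refl
inclusion-exclusion (suc r) x = begin
  ∑ (allSubsets (suc r)) (λ F → neg1^ ∣ F ∣ * ∏∈ F x)
    ≡⟨ ∑-subsets-suc r _ ⟩
  S + ∑ Fs (λ F → - neg1^ ∣ F ∣ * (x zero * ∏∈ F (x ∘ suc)))
    ≡⟨ cong (_+_ S) (trans (∑-cong Fs (λ F → pull (neg1^ ∣ F ∣) (x zero) _)) (∑-* Fs (- x zero) _)) ⟩
  S + (- x zero) * S
    ≡⟨ cong (λ z → z + (- x zero) * z) (inclusion-exclusion r (x ∘ suc)) ⟩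
  P + (- x zero) * P
    ≡⟨ factor (x zero) P ⟩
  (+ 1 - x zero) * P ∎
  where
  open ≡-Reasoning
  Fs : List (Subset r)
  Fs = allSubsets r
  S P : ℤ
  S = ∑ Fs (λ F → neg1^ ∣ F ∣ * ∏∈ F (x ∘ suc))
  P = ∏∈ ⊤ (λ l → + 1 - x (suc l))
  pull : ∀ e a p → - e * (a * p) ≡ (- a) * (e * p)
  pull = solve-∀
  factor : ∀ a p → p + (- a) * p ≡ (+ 1 - a) * p
  factor = solve-∀

𝟙-any : ∀ {ℓ} r {P : Pred (Fin r) ℓ} (P? : Decidable P) →
  𝟙 (any? P?) ≡ + 1 - ∏∈ ⊤ (λ l → + 1 - 𝟙 (P? l))
𝟙-any zero P? = refl
𝟙-any (suc r) P? with P? zero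
... | yes _ = sym (absorb (∏∈ ⊤ (λ l → + 1 - 𝟙 (P? (suc l)))))
  where
  absorb : ∀ a → + 1 - (+ 1 - + 1) * a ≡ + 1
  absorb = solve-∀
... | no _ = trans (𝟙-any r (P? ∘ suc)) (unit (∏∈ ⊤ (λ l → + 1 - 𝟙 (P? (suc l)))))
  where
  unit : ∀ a → + 1 - a ≡ + 1 - (+ 1 - + 0) * a
  unit = solve-∀

𝟙-all-in : ∀ {ℓ q} {r} (F : Subset r) {P : Pred (Fin r) ℓ} (P? : Decidable P) {Q : Set q} (d : Dec Q) →
  (Q → ∀ l → l ∈ F → P l) → ((∀ l → l ∈ F → P l) → Q) → 𝟙 d ≡ ∏∈ F (λ l → 𝟙 (P? l))
𝟙-all-in [] P? (yes _) to from = refl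
𝟙-all-in [] P? (no ¬q) to from = contradiction (from (λ _ ())) ¬q
𝟙-all-in (outside ∷ F) P? d to from =
  𝟙-all-in F (P? ∘ suc) d (λ q l l∈F → to q (suc l) (there l∈F))
    (λ h → from (λ { (suc l) (there l∈F) → h l l∈F }))
𝟙-all-in (inside ∷ F) {P} P? {Q} d to from = begin
  𝟙 d
    ≡⟨ 𝟙-cong (λ q → to q zero here , λ l l∈F → to q (suc l) (there l∈F)) split d (P? zero ×-dec rest?) ⟩
  𝟙 (P? zero ×-dec rest?)
    ≡⟨ 𝟙-× (P? zero) rest? ⟩
  𝟙 (P? zero) * 𝟙 rest?
    ≡⟨ cong (𝟙 (P? zero) *_) (𝟙-all-in F (P? ∘ suc) rest? (λ h → h) (λ h → h)) ⟩
  𝟙 (P? zero) * ∏∈ F (λ l → 𝟙 (P? (suc l))) ∎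
  where
  open ≡-Reasoning
  rest? : Dec (∀ l → l ∈ F → P (suc l))
  rest? = all? (λ l → (l ∈? F) →-dec P? (suc l))
  split : P zero × (∀ l → l ∈ F → P (suc l)) → Q
  split = λ { (p₀ , h) → from (λ { zero _ → p₀ ; (suc l) (there l∈F) → h l l∈F }) }

pascal : ∀ m k → + (m C k) + + (m C suc k) ≡ + (suc m C suc k)
pascal m k = trans (sym (ZP.pos-+ (m C k) _)) (cong +_ (nCk+nC[k+1]≡[n+1]C[k+1] m k))

count-subsets : ∀ n i (T : Subset n) →
  ∑ (allSubsets n) (λ S → 𝟙 (∣ S ∣ NP.≟ i) * 𝟙 (S ⊆? T)) ≡ + (∣ T ∣ C i)
count-subsets zero zero [] = refl
count-subsets zero (suc i) [] = refl
count-subsets (suc n) i (outside ∷ T) = begin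
  ∑ (allSubsets (suc n)) _                     ≡⟨ ∑-subsets-suc n _ ⟩
  ∑ Ss _ + ∑ Ss (λ S → 𝟙 (suc ∣ S ∣ NP.≟ i) * + 0)
    ≡⟨ cong₂ _+_ (count-subsets n i T) (∑-cong Ss (λ S → ZP.*-zeroʳ (𝟙 (suc ∣ S ∣ NP.≟ i)))) ⟩
  + (∣ T ∣ C i) + ∑ Ss (λ _ → + 0)              ≡⟨ cong (_+_ (+ (∣ T ∣ C i))) (∑-zero Ss) ⟩
  + (∣ T ∣ C i) + + 0                           ≡⟨ ZP.+-identityʳ _ ⟩
  + (∣ T ∣ C i)                                 ∎
  where
  open ≡-Reasoning
  Ss : List (Subset n)
  Ss = allSubsets n
count-subsets (suc n) zero (inside ∷ T) = begin
  ∑ (allSubsets (suc n)) _                        ≡⟨ ∑-subsets-suc n _ ⟩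
  ∑ Ss _ + ∑ Ss (λ S → + 0 * 𝟙 (S ⊆? T))          ≡⟨ cong₂ _+_ (count-subsets n 0 T) (∑-zero Ss) ⟩
  + (∣ T ∣ C 0) + + 0                              ≡⟨ ZP.+-identityʳ _ ⟩
  + (suc ∣ T ∣ C 0)                                ∎
  where
  open ≡-Reasoning
  Ss : List (Subset n)
  Ss = allSubsets n
count-subsets (suc n) (suc i) (inside ∷ T) = begin
  ∑ (allSubsets (suc n)) _                 ≡⟨ ∑-subsets-suc n _ ⟩
  ∑ Ss _ + ∑ Ss _                          ≡⟨ cong₂ _+_ (count-subsets n (suc i) T) (count-subsets n i T) ⟩
  + (∣ T ∣ C suc i) + + (∣ T ∣ C i)        ≡⟨ ZP.+-comm (+ (∣ T ∣ C suc i)) (+ (∣ T ∣ C i)) ⟩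
  + (∣ T ∣ C i) + + (∣ T ∣ C suc i)        ≡⟨ pascal ∣ T ∣ i ⟩
  + (suc ∣ T ∣ C suc i)                    ∎
  where
  open ≡-Reasoning
  Ss : List (Subset n)
  Ss = allSubsets n

module _ {n r} (A : Fin r → Subset n) where

  interSize : Subset r → ℕ
  interSize F = ∣ interFacets A F ∣

  ∈-interFacets⁻ : ∀ F {v} → v ∈ interFacets A F → ∀ l → l ∈ F → v ∈ A l
  ∈-interFacets⁻ F {v} v∈ =
    invert (subst (Reflects _) (trans (sym (lookup∘tabulate _ v)) ([]=⇒lookup v∈)) (proof v∈A?))
    where
    v∈A? : Dec (∀ l → l ∈ F → v ∈ A l)
    v∈A? = all? (λ l → (l ∈? F) →-dec (v ∈? A l))

  ∈-interFacets⁺ : ∀ F {v} → (∀ l → l ∈ F → v ∈ A l) → v ∈ interFacets A F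
  ∈-interFacets⁺ F {v} h = lookup⇒[]= v _
    (trans (lookup∘tabulate _ v) (dec-true (all? (λ l → (l ∈? F) →-dec (v ∈? A l))) h))

  𝟙-⊆-interFacets : ∀ F S → 𝟙 (S ⊆? interFacets A F) ≡ ∏∈ F (λ l → 𝟙 (S ⊆? A l))
  𝟙-⊆-interFacets F S = 𝟙-all-in F (λ l → S ⊆? A l) (S ⊆? interFacets A F)
    (λ S⊆ l l∈F x∈S → ∈-interFacets⁻ F (S⊆ x∈S) l l∈F)
    (λ h x∈S → ∈-interFacets⁺ F (λ l l∈F → h l l∈F x∈S))

  𝟙-face : ∀ S → 𝟙 (isFace? A S) ≡ signedSum (λ F → - 𝟙 (S ⊆? interFacets A F))
  𝟙-face S = begin
    𝟙 (isFace? A S)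
      ≡⟨ 𝟙-any r (λ l → S ⊆? A l) ⟩
    + 1 - ∏∈ ⊤ (λ l → + 1 - 𝟙 (S ⊆? A l))
      ≡⟨ cong (_-_ (+ 1)) (sym (inclusion-exclusion r _)) ⟩
    + 1 - ∑ (allSubsets r) (λ F → neg1^ ∣ F ∣ * ∏∈ F (λ l → 𝟙 (S ⊆? A l)))
      ≡⟨ cong (_-_ (+ 1)) (∑-cong (allSubsets r) (λ F → cong (neg1^ ∣ F ∣ *_) (sym (𝟙-⊆-interFacets F S)))) ⟩
    + 1 - ∑ (allSubsets r) (λ F → neg1^ ∣ F ∣ * y F)
      ≡⟨ cong (_-_ (+ 1)) (alternating-split r y) ⟩
    + 1 - (y ⊥ + signedSum y)
      ≡⟨ cong (λ z → + 1 - (z + signedSum y)) (trans (𝟙-⊆-interFacets ⊥ S) (∏∈-⊥ r _)) ⟩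
    + 1 - (+ 1 + signedSum y)
      ≡⟨ cancel (signedSum y) ⟩
    - signedSum y
      ≡⟨ signedSum-neg y ⟩
    signedSum (λ F → - y F) ∎
    where
    open ≡-Reasoning
    y : Subset r → ℤ
    y F = 𝟙 (S ⊆? interFacets A F)
    cancel : ∀ a → + 1 - (+ 1 + a) ≡ - a
    cancel = solve-∀

  fcard-nerve : ∀ i → + fcard A i ≡ signedSum (λ F → - + (interSize F C i))
  fcard-nerve i = begin
    + fcard A i
      ≡⟨ length-filter _ Ss ⟩
    ∑ Ss (λ S → 𝟙 ((∣ S ∣ NP.≟ i) ×-dec isFace? A S))
      ≡⟨ ∑-cong Ss (λ S → trans (𝟙-× (∣ S ∣ NP.≟ i) (isFace? A S)) (cong (a S *_) (𝟙-face S))) ⟩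
    ∑ Ss (λ S → a S * signedSum (λ F → - 𝟙 (S ⊆? interFacets A F)))
      ≡⟨ signedSum-combination Ss a (λ S F → - 𝟙 (S ⊆? interFacets A F)) ⟩
    signedSum (λ F → ∑ Ss (λ S → a S * - 𝟙 (S ⊆? interFacets A F)))
      ≡⟨ signedSum-cong (λ F _ → count F) ⟩
    signedSum (λ F → - + (interSize F C i)) ∎
    where
    open ≡-Reasoning
    Ss : List (Subset n)
    Ss = allSubsets n
    a : Subset n → ℤ
    a S = 𝟙 (∣ S ∣ NP.≟ i)
    count : ∀ F → ∑ Ss (λ S → a S * - 𝟙 (S ⊆? interFacets A F)) ≡ - + (interSize F C i)
    count F = trans (∑-cong Ss (λ S → sym (ZP.neg-distribʳ-* (a S) _)))
      (trans (∑-neg Ss _) (cong -_ (count-subsets n i (interFacets A F))))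

  interSize≤maxFacetSize : ∀ F → ¬ ∣ F ∣ ≡ 0 → interSize F ≤ maxFacetSize A
  interSize≤maxFacetSize F F≢∅ with nonempty? F
  ... | no F-empty = contradiction (trans (cong ∣_∣ (Empty-unique F-empty)) (∣⊥∣≡0 r)) F≢∅
  ... | yes (l , l∈F) =
    NP.≤-trans (p⊆q⇒∣p∣≤∣q∣ (λ v∈ → ∈-interFacets⁻ F v∈ l l∈F)) (facet≤max (allFin r) (∈-allFin l))
    where
    facet≤max : ∀ (ls : List (Fin r)) → l ∈ₗ ls → ∣ A l ∣ ≤ foldr (λ m b → ∣ A m ∣ ⊔ b) 0 ls
    facet≤max (_ ∷ ls) (Any.here refl) = NP.m≤m⊔n (∣ A l ∣) _
    facet≤max (m ∷ ls) (Any.there l∈ls) = NP.≤-trans (facet≤max ls l∈ls) (NP.m≤n⊔m (∣ A m ∣) _)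

range : ℕ → List ℕ
range zero = []
range (suc k) = range k ++ (k ∷ [])

∑-range-suc : ∀ k f → ∑ (range (suc k)) f ≡ ∑ (range k) f + f k
∑-range-suc k f = trans (∑-++ (range k) (k ∷ []) f) (cong (_+_ (∑ (range k) f)) (ZP.+-identityʳ (f k)))

∑-range-shift : ∀ k f → ∑ (range (suc k)) f ≡ f 0 + ∑ (range k) (f ∘ suc)
∑-range-shift zero f = refl
∑-range-shift (suc k) f = begin
  ∑ (range (suc (suc k))) f                         ≡⟨ ∑-range-suc (suc k) f ⟩
  ∑ (range (suc k)) f + f (suc k)                   ≡⟨ cong (_+ f (suc k)) (∑-range-shift k f) ⟩
  (f 0 + ∑ (range k) (f ∘ suc)) + f (suc k)         ≡⟨ ZP.+-assoc (f 0) _ _ ⟩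
  f 0 + (∑ (range k) (f ∘ suc) + f (suc k))         ≡⟨ cong (_+_ (f 0)) (sym (∑-range-suc k (f ∘ suc))) ⟩
  f 0 + ∑ (range (suc k)) (f ∘ suc)                 ∎
  where open ≡-Reasoning

sumFromTo-0 : ∀ k g → sumFromTo 0 k g ≡ ∑ (range (suc k)) g
sumFromTo-0 zero g = sym (ZP.+-identityʳ (g 0))
sumFromTo-0 (suc k) g = trans (cong (_+ g (suc k)) (sumFromTo-0 k g)) (sym (∑-range-suc (suc k) g))

sumFromTo-1 : ∀ d g → sumFromTo 1 d g ≡ ∑ (range d) (g ∘ suc)
sumFromTo-1 zero g = refl
sumFromTo-1 (suc d) g = trans (cong (_+ g (suc d)) (sumFromTo-1 d g)) (sym (∑-range-suc d (g ∘ suc)))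

-- The h-transform in dimension d of a sequence f (f i standing for f_{i-1}):
--   Σ_{i=0}^{k} binom(d-i, k-i) (-1)^{k-i} f i.
hTransform : ℕ → ℕ → (ℕ → ℤ) → ℤ
hTransform d k f = ∑ (range (suc k)) (λ i → + ((d ∸ i) C (k ∸ i)) * (neg1^ (k ∸ i) * f i))

hTransform-cong : ∀ d k {f g : ℕ → ℤ} → (∀ i → f i ≡ g i) → hTransform d k f ≡ hTransform d k g
hTransform-cong d k eq = ∑-cong (range (suc k)) (λ i → cong (λ z → + ((d ∸ i) C (k ∸ i)) * (neg1^ (k ∸ i) * z)) (eq i))

hTransform-neg : ∀ d k f → hTransform d k (λ i → - f i) ≡ - hTransform d k f
hTransform-neg d k f = trans (∑-cong (range (suc k)) (λ i → push (+ ((d ∸ i) C (k ∸ i))) (neg1^ (k ∸ i)) (f i)))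
  (∑-neg (range (suc k)) _)
  where
  push : ∀ c σ x → c * (σ * - x) ≡ - (c * (σ * x))
  push = solve-∀

hTransform-signedSum : ∀ {r} d k (g : ℕ → Subset r → ℤ) →
  hTransform d k (λ i → signedSum (g i)) ≡ signedSum (λ F → hTransform d k (λ i → g i F))
hTransform-signedSum d k g = begin
  hTransform d k (λ i → signedSum (g i))
    ≡⟨ ∑-cong (range (suc k)) (λ i → sym (ZP.*-assoc (c i) (σ i) _)) ⟩
  ∑ (range (suc k)) (λ i → (c i * σ i) * signedSum (g i))
    ≡⟨ signedSum-combination (range (suc k)) (λ i → c i * σ i) g ⟩
  signedSum (λ F → ∑ (range (suc k)) (λ i → (c i * σ i) * g i F))
    ≡⟨ signedSum-cong (λ F _ → ∑-cong (range (suc k)) (λ i → ZP.*-assoc (c i) (σ i) (g i F))) ⟩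
  signedSum (λ F → hTransform d k (λ i → g i F)) ∎
  where
  open ≡-Reasoning
  c σ : ℕ → ℤ
  c i = + ((d ∸ i) C (k ∸ i))
  σ i = neg1^ (k ∸ i)

hTransform-pascal : ∀ d s k →
  hTransform (suc d) (suc k) (λ i → + (suc s C i))
    ≡ hTransform (suc d) (suc k) (λ i → + (s C i)) + hTransform d k (λ i → + (s C i))
hTransform-pascal d s k = begin
  hTransform (suc d) (suc k) (λ i → + (suc s C i))
    ≡⟨ ∑-range-shift (suc k) _ ⟩
  t₀ + ∑ is (λ i → c i * (σ i * + (suc s C suc i)))
    ≡⟨ cong (_+_ t₀) (∑-cong is (λ i → cong (λ z → c i * (σ i * z)) (sym (pascal s i)))) ⟩
  t₀ + ∑ is (λ i → c i * (σ i * (+ (s C i) + + (s C suc i))))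
    ≡⟨ cong (_+_ t₀) (trans (∑-cong is (λ i → distrib (c i) (σ i) _ _)) (∑-+ is _ _)) ⟩
  t₀ + (∑ is (λ i → c i * (σ i * + (s C i))) + ∑ is (λ i → c i * (σ i * + (s C suc i))))
    ≡⟨ rearrange t₀ _ _ ⟩
  (t₀ + ∑ is (λ i → c i * (σ i * + (s C suc i)))) + ∑ is (λ i → c i * (σ i * + (s C i)))
    ≡⟨ cong (_+ hTransform d k (λ i → + (s C i))) (sym (∑-range-shift (suc k) _)) ⟩
  hTransform (suc d) (suc k) (λ i → + (s C i)) + hTransform d k (λ i → + (s C i)) ∎
  where
  open ≡-Reasoning
  is : List ℕ
  is = range (suc k)
  t₀ : ℤ
  t₀ = + (suc d C suc k) * (neg1^ (suc k) * + 1)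
  c σ : ℕ → ℤ
  c i = + ((d ∸ i) C (k ∸ i))
  σ i = neg1^ (k ∸ i)
  distrib : ∀ c σ a b → c * (σ * (a + b)) ≡ c * (σ * a) + c * (σ * b)
  distrib = solve-∀
  rearrange : ∀ t b a → t + (b + a) ≡ (t + a) + b
  rearrange = solve-∀

-- The h-vector of an (s-1)-simplex viewed in dimension e + s - 1:
--   Σ_{i=0}^{k} binom(e+s-i, k-i) (-1)^{k-i} binom(s, i) = (-1)^k binom(e, k).
hTransform-simplex : ∀ s e k → hTransform (e ℕ.+ s) k (λ i → + (s C i)) ≡ neg1^ k * + (e C k)
hTransform-simplex zero e k = begin
  hTransform (e ℕ.+ 0) k (λ i → + (0 C i))
    ≡⟨ ∑-range-shift k _ ⟩
  + ((e ℕ.+ 0) C k) * (neg1^ k * + 1) + ∑ (range k) (λ i → c i * (σ i * + 0))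
    ≡⟨ cong₂ _+_ (cong (λ m → + (m C k) * (neg1^ k * + 1)) (NP.+-identityʳ e))
                 (trans (∑-cong (range k) (λ i → vanish (c i) (σ i))) (∑-zero (range k))) ⟩
  + (e C k) * (neg1^ k * + 1) + + 0
    ≡⟨ tidy (+ (e C k)) (neg1^ k) ⟩
  neg1^ k * + (e C k) ∎
  where
  open ≡-Reasoning
  c σ : ℕ → ℤ
  c i = + ((e ℕ.+ 0 ∸ suc i) C (k ∸ suc i))
  σ i = neg1^ (k ∸ suc i)
  vanish : ∀ c σ → c * (σ * + 0) ≡ + 0
  vanish = solve-∀
  tidy : ∀ b σ → b * (σ * + 1) + + 0 ≡ σ * b
  tidy = solve-∀
hTransform-simplex (suc s) e zero = refl
hTransform-simplex (suc s) e (suc k) rewrite NP.+-suc e s = begin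
  hTransform (suc (e ℕ.+ s)) (suc k) (λ i → + (suc s C i))
    ≡⟨ hTransform-pascal (e ℕ.+ s) s k ⟩
  hTransform (suc e ℕ.+ s) (suc k) (λ i → + (s C i)) + hTransform (e ℕ.+ s) k (λ i → + (s C i))
    ≡⟨ cong₂ _+_ (hTransform-simplex s (suc e) (suc k)) (hTransform-simplex s e k) ⟩
  - neg1^ k * + (suc e C suc k) + neg1^ k * + (e C k)
    ≡⟨ cong (λ z → - neg1^ k * z + neg1^ k * + (e C k)) (sym (pascal e k)) ⟩
  - neg1^ k * (+ (e C k) + + (e C suc k)) + neg1^ k * + (e C k)
    ≡⟨ cancel (neg1^ k) (+ (e C k)) (+ (e C suc k)) ⟩
  - neg1^ k * + (e C suc k) ∎
  where
  open ≡-Reasoning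
  cancel : ∀ σ a b → - σ * (a + b) + σ * a ≡ - σ * b
  cancel = solve-∀

hTransform-binomial : ∀ {s d} k → s ≤ d → hTransform d k (λ i → + (s C i)) ≡ neg1^ k * + ((d ∸ s) C k)
hTransform-binomial {s} {d} k s≤d = begin
  hTransform d k (λ i → + (s C i))
    ≡⟨ cong (λ m → hTransform m k (λ i → + (s C i))) (sym (NP.m∸n+n≡m s≤d)) ⟩
  hTransform (d ∸ s ℕ.+ s) k (λ i → + (s C i))
    ≡⟨ hTransform-simplex s (d ∸ s) k ⟩
  neg1^ k * + ((d ∸ s) C k) ∎
  where open ≡-Reasoning

hockey-stick : ∀ d k → ∑ (range d) (λ j → + ((d ∸ suc j) C k)) ≡ + (d C suc k)
hockey-stick zero k = refl
hockey-stick (suc d) k = begin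
  ∑ (range (suc d)) (λ j → + ((suc d ∸ suc j) C k))   ≡⟨ ∑-range-shift d _ ⟩
  + (d C k) + ∑ (range d) (λ j → + ((d ∸ suc j) C k)) ≡⟨ cong (_+_ (+ (d C k))) (hockey-stick d k) ⟩
  + (d C k) + + (d C suc k)                          ≡⟨ pascal d k ⟩
  + (suc d C suc k)                                  ∎
  where open ≡-Reasoning

hockey-stick-tail : ∀ s d k → s ≤ d →
  ∑ (range d) (λ j → + ((d ∸ suc j) C k) * (+ 1 - 𝟙 (suc j NP.≤? s))) ≡ + ((d ∸ s) C suc k)
hockey-stick-tail zero d k _ =
  trans (∑-cong (range d) (λ j → ZP.*-identityʳ _)) (hockey-stick d k)
hockey-stick-tail (suc s) (suc d) k (s≤s s≤d) =
  trans (∑-range-shift d _)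
    (trans (cong₂ _+_ (ZP.*-zeroʳ (+ (d C k))) (hockey-stick-tail s d k s≤d)) (ZP.+-identityˡ _))

faceSign≡ : ∀ m → faceSign m ≡ - neg1^ m
faceSign≡ zero = refl
faceSign≡ (suc m) = sym (ZP.neg-involutive (neg1^ m))

module _ {n r} (A : Fin (suc r) → Subset n) where

  -- χ̃(N_{j+1}(Δ)) = Φ(F ↦ [s_F ≤ j]); this uses that there is at least one facet.
  redEulerNerve-signedSum : ∀ j →
    redEulerNerve A (suc j) ≡ signedSum (λ F → + 1 - 𝟙 (suc j NP.≤? interSize A F))
  redEulerNerve-signedSum j = begin
    redEulerNerve A (suc j)
      ≡⟨ ∑-filter (inNerve? A (suc j)) Fs _ ⟩
    ∑ Fs (λ F → 𝟙 (N? F) * faceSign ∣ F ∣)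
      ≡⟨ ∑-cong Fs (λ F → trans (cong (𝟙 (N? F) *_) (faceSign≡ ∣ F ∣)) (sym (ZP.neg-distribʳ-* (𝟙 (N? F)) (neg1^ ∣ F ∣)))) ⟩
    ∑ Fs (λ F → - (𝟙 (N? F) * neg1^ ∣ F ∣))
      ≡⟨ trans (∑-neg Fs _) (cong -_ (∑-cong Fs (λ F → ZP.*-comm (𝟙 (N? F)) _))) ⟩
    - ∑ Fs (λ F → neg1^ ∣ F ∣ * 𝟙 (N? F))
      ≡⟨ sym (alternating-complement r _) ⟩
    ∑ Fs (λ F → neg1^ ∣ F ∣ * (+ 1 - 𝟙 (N? F)))
      ≡⟨ alternating-split (suc r) _ ⟩
    (+ 1 - 𝟙 (N? ⊥)) + signedSum (λ F → + 1 - 𝟙 (N? F))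
      ≡⟨ cong₂ _+_ (cong (_-_ (+ 1)) (𝟙-yes (N? ⊥) (inj₁ (∣⊥∣≡0 (suc r))))) (signedSum-cong nerve-nonempty) ⟩
    + 0 + signedSum (λ F → + 1 - 𝟙 (suc j NP.≤? interSize A F))
      ≡⟨ ZP.+-identityˡ _ ⟩
    signedSum (λ F → + 1 - 𝟙 (suc j NP.≤? interSize A F)) ∎
    where
    open ≡-Reasoning
    Fs : List (Subset (suc r))
    Fs = allSubsets (suc r)
    N? : ∀ F → Dec (InNerve A (suc j) F)
    N? = inNerve? A (suc j)
    nerve-nonempty : ∀ F → ¬ ∣ F ∣ ≡ 0 →
      + 1 - 𝟙 (N? F) ≡ + 1 - 𝟙 (suc j NP.≤? interSize A F)
    nerve-nonempty F F≢∅ = cong (_-_ (+ 1))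
      (𝟙-cong (λ { (inj₁ F≡∅) → contradiction F≡∅ F≢∅ ; (inj₂ big) → big }) inj₂ (N? F) (suc j NP.≤? interSize A F))

  hVec-signedSum : ∀ k →
    hVec A (suc k) ≡ signedSum (λ F → neg1^ k * + ((maxFacetSize A ∸ interSize A F) C suc k))
  hVec-signedSum k = begin
    hVec A (suc k)
      ≡⟨ sumFromTo-0 (suc k) _ ⟩
    hTransform d (suc k) (λ i → + fcard A i)
      ≡⟨ hTransform-cong d (suc k) (fcard-nerve A) ⟩
    hTransform d (suc k) (λ i → signedSum (λ F → - + (interSize A F C i)))
      ≡⟨ hTransform-signedSum d (suc k) (λ i F → - + (interSize A F C i)) ⟩
    signedSum (λ F → hTransform d (suc k) (λ i → - + (interSize A F C i)))
      ≡⟨ signedSum-cong simplex ⟩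
    signedSum (λ F → neg1^ k * + ((d ∸ interSize A F) C suc k)) ∎
    where
    open ≡-Reasoning
    d : ℕ
    d = maxFacetSize A
    simplex : ∀ F → ¬ ∣ F ∣ ≡ 0 →
      hTransform d (suc k) (λ i → - + (interSize A F C i)) ≡ neg1^ k * + ((d ∸ interSize A F) C suc k)
    simplex F F≢∅ = begin
      hTransform d (suc k) (λ i → - + (interSize A F C i))
        ≡⟨ hTransform-neg d (suc k) _ ⟩
      - hTransform d (suc k) (λ i → + (interSize A F C i))
        ≡⟨ cong -_ (hTransform-binomial (suc k) (interSize≤maxFacetSize A F F≢∅)) ⟩
      - (- neg1^ k * + ((d ∸ interSize A F) C suc k))
        ≡⟨ cong -_ (sym (ZP.neg-distribˡ-* (neg1^ k) _)) ⟩
      - - (neg1^ k * + ((d ∸ interSize A F) C suc k))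
        ≡⟨ ZP.neg-involutive _ ⟩
      neg1^ k * + ((d ∸ interSize A F) C suc k) ∎

  eulerSum-signedSum : ∀ k →
    neg1^ k * sumFromTo 1 (maxFacetSize A) (λ j → + ((maxFacetSize A ∸ j) C k) * redEulerNerve A j)
      ≡ signedSum (λ F → neg1^ k * + ((maxFacetSize A ∸ interSize A F) C suc k))
  eulerSum-signedSum k = begin
    neg1^ k * sumFromTo 1 d (λ j → + ((d ∸ j) C k) * redEulerNerve A j)
      ≡⟨ cong (neg1^ k *_) (sumFromTo-1 d _) ⟩
    neg1^ k * ∑ (range d) (λ j → c j * redEulerNerve A (suc j))
      ≡⟨ cong (neg1^ k *_) (∑-cong (range d) (λ j → cong (c j *_) (redEulerNerve-signedSum j))) ⟩
    neg1^ k * ∑ (range d) (λ j → c j * signedSum (b j))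
      ≡⟨ cong (neg1^ k *_) (signedSum-combination (range d) c b) ⟩
    neg1^ k * signedSum (λ F → ∑ (range d) (λ j → c j * b j F))
      ≡⟨ signedSum-scale (neg1^ k) (λ F → ∑ (range d) (λ j → c j * b j F)) ⟩
    signedSum (λ F → neg1^ k * ∑ (range d) (λ j → c j * b j F))
      ≡⟨ signedSum-cong (λ F F≢∅ → cong (neg1^ k *_)
           (hockey-stick-tail (interSize A F) d k (interSize≤maxFacetSize A F F≢∅))) ⟩
    signedSum (λ F → neg1^ k * + ((d ∸ interSize A F) C suc k)) ∎
    where
    open ≡-Reasoning
    d : ℕ
    d = maxFacetSize A
    c : ℕ → ℤ
    c j = + ((d ∸ suc j) C k)
    b : ℕ → Subset (suc r) → ℤ
    b j F = + 1 - 𝟙 (suc j NP.≤? interSize A F)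

-- Corollary 6.2: h_k(Δ) = (-1)^{k-1} Σ_{j=1}^{d} binom(d-j, k-1) χ̃(N_j(Δ)) for k ≥ 1.
-- Both sides equal Φ(F ↦ (-1)^{k-1} binom(d - s_F, k)); the facet hypotheses are
-- only needed to guarantee r ≥ 1.
corollary6p2 : (n r : ℕ) (A : Fin r → Subset n)
    → (∀ l m → A l ⊆ A m → l ≡ m)
    → (∃ λ l → Nonempty (A l))
    → (k : ℕ) → 1 ≤ k
    → hVec A k
      ≡ neg1^ (k ∸ 1)
        * sumFromTo 1 (maxFacetSize A)
            (λ j → + ((maxFacetSize A ∸ j) C (k ∸ 1)) * redEulerNerve A j)
corollary6p2 n zero A _ (() , _) _ _
corollary6p2 n (suc r) A _ _ (suc k) _ = trans (hVec-signedSum A k) (sym (eulerSum-signedSum A k))
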